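{- Let $p$ be a prime, $k$ a positive integer, $q=p^k$, $f(x)\in\mathbb F_q[x]$ and $a\in\mathbb F_q$. Then the generating series $\sum_{s=1}^{\infty}N_s(f,a)x^s$ is a rational function in $x$. Furthermore, let $d:=\deg\{u_s(f,a)\}_{s=1}^{\infty}$, let $A:=(u_{i+j-1}(f,a))_{1\le i,j\le d+1}$ be the $(d+1)\times(d+1)$ Hankel matrix associated with the sequence $\{u_s(f,a)\}_{s\ge1}$, and let $X=(c_d,\dots,c_1,c_0)^T$ be any nonzero integer solution of $AX=0$. Then $$\sum_{s=1}^{\infty}N_s(f,a)x^s=\frac{x}{1-qx}+\frac{\sum_{i=1}^{d}\Big(\sum_{j+k=i,\ k\ge0,\ j\ge1}c_k\,u_j(f,a)\Big)x^i}{\sum_{i=0}^{d}c_ix^i}.$$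
   Context: $\mathbb F_q$ is the finite field with $q=p^k$ elements. For $s\ge1$, $N_s(f,a)$ is the number of $(x_1,\dots,x_s)\in\mathbb F_q^s$ with $f(x_1)+\cdots+f(x_s)=a$, and $u_s(f,a):=N_s(f,a)-q^{s-1}$. The sequence $\{u_s(f,a)\}_{s\ge1}$ is a linear recursion sequence, where: a sequence of integers $\{a_s\}_{s\ge1}$ is a linear recursion sequence if there exists $g(x)=\sum_{i=0}^d k_ix^i\in\mathbb Z[x]$ with $k_d\neq0$ such that $k_0a_{j+1}+k_1a_{j+2}+\cdots+k_da_{j+d+1}=0$ for all integers $j\ge0$ (such $g$ is a generating polynomial). The generating polynomials form a principal ideal of $\mathbb Z[x]$ generated by a generating polynomial of minimal degree whose coefficients have gcd $1$, the minimal polynomial of the sequence; the degree $\deg\{a_s\}_{s\ge1}$ of the sequence is the degree of its minimal polynomial. -}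

module Defs where

open import Data.Nat as ℕ using (ℕ; zero; suc; _≤_; _<_; _^_)
open import Data.Nat.Primality using (Prime)
open import Data.Integer as ℤ using (ℤ; +_)
open import Data.Fin as Fin using (Fin; toℕ; fromℕ; fromℕ<; opposite)
open import Data.Fin.Properties using ()
open import Data.List as List using (List; []; _∷_; map; filter; length; allFin; concatMap)
open import Data.Vec as Vec using (Vec; []; _∷_)
open import Data.Product using (Σ; ∃; ∃-syntax; _×_; _,_)
open import Relation.Nullary using (¬_; yes; no)
open import Relation.Binary.PropositionalEquality using (_≡_; _≢_)
open import Relation.Binary.Definitions using (DecidableEquality)
open import Algebra.Structures using (IsCommutativeRing)
open import Function.Bundles using (Inverse; _↔_)

record FiniteField (q : ℕ) : Set₁ where
  infixl 6 _+F_
  infixl 7 _*F_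
  field
    Carrier  : Set
    _+F_     : Carrier → Carrier → Carrier
    _*F_     : Carrier → Carrier → Carrier
    -F_      : Carrier → Carrier
    0F       : Carrier
    1F       : Carrier
    isCommutativeRing : IsCommutativeRing _≡_ _+F_ _*F_ -F_ 0F 1F
    0≢1      : 0F ≢ 1F
    inverse  : ∀ x → x ≢ 0F → ∃[ y ] (x *F y ≡ 1F)
    _≟F_     : DecidableEquality Carrier
    enum     : Fin q ↔ Carrier

  elements : List Carrier
  elements = map (Inverse.to enum) (allFin q)

  -- polynomials over F as coefficient lists (constant term first)
  eval : List Carrier → Carrier → Carrier
  eval []       x = 0F
  eval (c ∷ cs) x = c +F x *F eval cs x

  sumF : ∀ {s} → Vec Carrier s → Carrier
  sumF []       = 0F
  sumF (x ∷ xs) = x +F sumF xs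

  tuples : (s : ℕ) → List (Vec Carrier s)
  tuples zero    = [] ∷ []
  tuples (suc s) = concatMap (λ x → map (x ∷_) (tuples s)) elements

  N : List Carrier → Carrier → ℕ → ℕ
  N f a s = length (filter (λ v → sumF (Vec.map (eval f) v) ≟F a) (tuples s))

  -- u_s(f,a) = N_s(f,a) - q^(s-1)   (only meaningful for s ≥ 1)
  u : List Carrier → Carrier → ℕ → ℤ
  u f a s = + N f a s ℤ.- + (q ^ (s ℕ.∸ 1))

ΣFin : (n : ℕ) → (Fin n → ℤ) → ℤ
ΣFin zero    g = + 0
ΣFin (suc n) g = g Fin.zero ℤ.+ ΣFin n (λ i → g (Fin.suc i))

Σ< : ℕ → (ℕ → ℤ) → ℤ
Σ< zero    g = + 0
Σ< (suc n) g = Σ< n g ℤ.+ g n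

-- Linear recursion sequences.  A sequence {a_s}_{s≥1} is given as
-- a : ℕ → ℤ, where only the values a 1, a 2, ... matter.

IsGenPoly : (ℕ → ℤ) → (d : ℕ) → (Fin (suc d) → ℤ) → Set
IsGenPoly a d k =
  (k (fromℕ d) ≢ + 0) ×
  (∀ (j : ℕ) → ΣFin (suc d) (λ i → k i ℤ.* a (j ℕ.+ toℕ i ℕ.+ 1)) ≡ + 0)

IsLinRecSeq : (ℕ → ℤ) → Set
IsLinRecSeq a = ∃[ d ] ∃[ k ] IsGenPoly a d k

SeqDeg : (ℕ → ℤ) → ℕ → Set
SeqDeg a d =
  (∃[ k ] IsGenPoly a d k) ×
  (∀ (e : ℕ) (k : Fin (suc e) → ℤ) → IsGenPoly a e k → d ≤ e)

-- Hankel matrix A = (a_{i+j-1})_{1≤i,j≤d+1}  (0-based: a_{i+j+1})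

Hankel : (ℕ → ℤ) → (d : ℕ) → Fin (suc d) → Fin (suc d) → ℤ
Hankel a d i j = a (toℕ i ℕ.+ toℕ j ℕ.+ 1)

_·_ : ∀ {n} → (Fin n → Fin n → ℤ) → (Fin n → ℤ) → (Fin n → ℤ)
_·_ {n} M X i = ΣFin n (λ j → M i j ℤ.* X j)

-- Formal power series over ℤ as coefficient sequences ℕ → ℤ

conv : (ℕ → ℤ) → (ℕ → ℤ) → (ℕ → ℤ)
conv a b n = Σ< (suc n) (λ i → a i ℤ.* b (n ℕ.∸ i))

IsPoly : (ℕ → ℤ) → Set
IsPoly P = ∃[ m ] (∀ n → m ≤ n → P n ≡ + 0)

xSer : ℕ → ℤ
xSer 1 = + 1
xSer _ = + 0

oneMinusQx : ℕ → ℤ → ℤ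
oneMinusQx 0 q = + 1
oneMinusQx 1 q = ℤ.- q
oneMinusQx _ q = + 0

ext : ∀ {d} → (Fin (suc d) → ℤ) → ℕ → ℤ
ext {d} c i with i ℕ.<? suc d
... | yes i<  = c (fromℕ< i<)
... | no  _   = + 0

NSer : (ℕ → ℕ) → ℕ → ℤ
NSer N 0       = + 0
NSer N (suc s) = + N (suc s)

numer : (d : ℕ) → (ℕ → ℤ) → (ℕ → ℤ) → ℕ → ℤ
numer d c u 0 = + 0
numer d c u (suc i) with suc i ℕ.≤? d
... | yes _ = Σ< (suc i) (λ k → c k ℤ.* u (suc i ℕ.∸ k))
... | no  _ = + 0

{-# OPTIONS --safe #-}
-- The q + 1 functions b ↦ N_i(f, b) (0 ≤ i ≤ q) on the q-element field are ℤ-linearly dependent, and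
-- the recursion N_(s+1)(f, b) = Σ_x N_s(f, b - f(x)) carries such a relation to every shift; so N_s(f, a)
-- satisfies a linear recurrence, and multiplying Σ N_s x^s by the reciprocal polynomial of the recurrence
-- leaves a polynomial. For the formula, a kernel vector X of the Hankel matrix makes the first d + 1 terms
-- of b_t = Σ_l X_l u_(t+l+1) vanish; b satisfies the degree-d recurrence of u, hence b = 0, i.e. X is a
-- recurrence for u. Splitting N_s = u_s + q^(s-1) and using (1 - q x) Σ_(s≥1) q^(s-1) x^s = x gives the
-- identity with the denominators (1 - q x) and Σ c_i x^i cleared.
module Submission where

open import Defs
open import Level using (0ℓ)
open import Function using (_∘_)
open import Function.Bundles using (Inverse)
open import Data.Nat as ℕ using (ℕ; zero; suc; _≤_; _<_; _^_; _∸_; z≤n; s≤s)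
import Data.Nat.Properties as ℕP
import Data.Nat.Tactic.RingSolver as ℕ-Solver
open import Data.Nat.Primality using (Prime)
import Data.Nat.ListAction as ℕ-List
open import Data.Integer as ℤ using (ℤ; +_; _+_; _*_; _-_; -_)
import Data.Integer.Properties as ℤP
open import Data.Integer.Tactic.RingSolver using (solve-∀)
open import Data.Fin using (Fin; zero; suc; toℕ; fromℕ; fromℕ<; inject₁; opposite; punchIn)
import Data.Fin.Properties as FinP
import Data.Fin.Permutation as Perm
open import Data.List as List using (List; []; _∷_; map; filter; length; concatMap; tabulate)
import Data.List.Properties as ListP
open import Data.Vec as Vec using (Vec)
open import Data.Vec.Functional using (insertAt)
open import Data.Vec.Functional.Properties using (insertAt-lookup; insertAt-punchIn)
open import Data.Product using (Σ-syntax; ∃-syntax; _×_; _,_; proj₁; proj₂)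
open import Data.Sum using (inj₁; inj₂; [_,_]′)
open import Relation.Nullary using (yes; no; ¬?; contradiction)
open import Relation.Nullary.Decidable using (decidable-stable)
open import Relation.Unary using (Pred; Decidable; _≐_)
open import Relation.Binary.PropositionalEquality
open import Algebra.Bundles using (CommutativeRing)
import Algebra.Properties.Group as GroupProperties
import Algebra.Properties.Quasigroup as QuasigroupProperties
open import Algebra.Properties.Semiring.Sum ℤP.+-*-semiring
  using (sum; sum-syntax; sum-cong-≗; sum-replicate-zero; sum-init-last; sum-remove;
         ∑-permute; ∑-distrib-+; ∑-comm; *-distribˡ-sum)
open ≡-Reasoning

ΣFin≡∑ : ∀ n (g : Fin n → ℤ) → ΣFin n g ≡ sum g
ΣFin≡∑ zero    g = refl
ΣFin≡∑ (suc n) g = cong (_+_ (g zero)) (ΣFin≡∑ n (λ i → g (suc i)))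

Σ<≡∑ : ∀ n (g : ℕ → ℤ) → Σ< n g ≡ ∑[ i < n ] g (toℕ i)
Σ<≡∑ zero    g = refl
Σ<≡∑ (suc n) g = begin
  Σ< n g + g n                                        ≡⟨ cong (_+ g n) (Σ<≡∑ n g) ⟩
  ∑[ i < n ] g (toℕ i) + g n                          ≡⟨ cong₂ _+_ (sum-cong-≗ {n} λ i → cong g (sym (FinP.toℕ-inject₁ i)))
                                                                   (cong g (sym (FinP.toℕ-fromℕ n))) ⟩
  ∑[ i < n ] g (toℕ (inject₁ i)) + g (toℕ (fromℕ n))  ≡⟨ sum-init-last {n} (λ i → g (toℕ i)) ⟨
  ∑[ i < suc n ] g (toℕ i)                            ∎

∑-≡0 : ∀ {n} (g : Fin n → ℤ) → (∀ i → g i ≡ + 0) → sum g ≡ + 0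
∑-≡0 {n} g g≡0 = trans (sum-cong-≗ g≡0) (sum-replicate-zero n)

∑-reverse : ∀ {n} (g : Fin n → ℤ) → sum g ≡ sum (g ∘ opposite)
∑-reverse g = ∑-permute g Perm.reverse

Σ<-cong : ∀ n {f g : ℕ → ℤ} → (∀ i → i < n → f i ≡ g i) → Σ< n f ≡ Σ< n g
Σ<-cong zero    f≡g = refl
Σ<-cong (suc n) f≡g = cong₂ _+_ (Σ<-cong n λ i i<n → f≡g i (ℕP.m<n⇒m<1+n i<n)) (f≡g n (ℕP.n<1+n n))

Σ<-pad : ∀ {m n} (f : ℕ → ℤ) → (∀ i → m ≤ i → f i ≡ + 0) → m ≤ n → Σ< n f ≡ Σ< m f
Σ<-pad {n = zero}  f f≡0 z≤n = refl
Σ<-pad {m} {suc n} f f≡0 m≤1+n with ℕP.m≤n⇒m<n∨m≡n m≤1+n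
... | inj₂ refl      = refl
... | inj₁ (s≤s m≤n) = begin
  Σ< n f + f n  ≡⟨ cong₂ _+_ (Σ<-pad f f≡0 m≤n) (f≡0 n m≤n) ⟩
  Σ< m f + + 0  ≡⟨ ℤP.+-identityʳ _ ⟩
  Σ< m f        ∎

conv≡∑ : ∀ (a b : ℕ → ℤ) n → conv a b n ≡ ∑[ i < suc n ] (a (toℕ i) * b (n ∸ toℕ i))
conv≡∑ a b n = Σ<≡∑ (suc n) (λ i → a i * b (n ∸ i))

conv-suc : ∀ (a b : ℕ → ℤ) n → conv a b (suc n) ≡ a 0 * b (suc n) + conv (a ∘ suc) b n
conv-suc a b n = trans (conv≡∑ a b (suc n)) (cong (_+_ (a 0 * b (suc n))) (sym (conv≡∑ (a ∘ suc) b n)))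

conv-congˡ : ∀ (a a′ b : ℕ → ℤ) → a ≗ a′ → conv a b ≗ conv a′ b
conv-congˡ a a′ b a≗a′ n = Σ<-cong (suc n) λ i _ → cong (_* b (n ∸ i)) (a≗a′ i)

conv-congʳ : ∀ (a b b′ : ℕ → ℤ) → b ≗ b′ → conv a b ≗ conv a b′
conv-congʳ a b b′ b≗b′ n = Σ<-cong (suc n) λ i _ → cong (a i *_) (b≗b′ (n ∸ i))

conv-comm : ∀ (a b : ℕ → ℤ) → conv a b ≗ conv b a
conv-comm a b n = begin
  conv a b n                                                        ≡⟨ conv≡∑ a b n ⟩
  ∑[ i < suc n ] (a (toℕ i) * b (n ∸ toℕ i))                        ≡⟨ ∑-reverse (λ i → a (toℕ i) * b (n ∸ toℕ i)) ⟩
  ∑[ i < suc n ] (a (toℕ (opposite i)) * b (n ∸ toℕ (opposite i)))  ≡⟨ sum-cong-≗ {suc n} summand ⟩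
  ∑[ i < suc n ] (b (toℕ i) * a (n ∸ toℕ i))                        ≡⟨ conv≡∑ b a n ⟨
  conv b a n                                                        ∎
  where
  summand : ∀ (i : Fin (suc n)) → a (toℕ (opposite i)) * b (n ∸ toℕ (opposite i)) ≡ b (toℕ i) * a (n ∸ toℕ i)
  summand i rewrite FinP.opposite-prop i | ℕP.m∸[m∸n]≡n (ℕ.s≤s⁻¹ (FinP.toℕ<n i)) =
    ℤP.*-comm (a (n ∸ toℕ i)) (b (toℕ i))

conv-+ʳ : ∀ (a b c : ℕ → ℤ) n → conv a (λ i → b i + c i) n ≡ conv a b n + conv a c n
conv-+ʳ a b c n = begin
  conv a (λ i → b i + c i) n
    ≡⟨ conv≡∑ a (λ i → b i + c i) n ⟩
  ∑[ i < suc n ] (a (toℕ i) * (b (n ∸ toℕ i) + c (n ∸ toℕ i)))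
    ≡⟨ sum-cong-≗ {suc n} (λ i → ℤP.*-distribˡ-+ (a (toℕ i)) (b (n ∸ toℕ i)) (c (n ∸ toℕ i))) ⟩
  ∑[ i < suc n ] (ab i + ac i)
    ≡⟨ ∑-distrib-+ ab ac ⟩
  ∑[ i < suc n ] ab i + ∑[ i < suc n ] ac i
    ≡⟨ cong₂ _+_ (conv≡∑ a b n) (conv≡∑ a c n) ⟨
  conv a b n + conv a c n
    ∎
  where
  ab ac : Fin (suc n) → ℤ
  ab i = a (toℕ i) * b (n ∸ toℕ i)
  ac i = a (toℕ i) * c (n ∸ toℕ i)

conv-linearˡ : ∀ (a b : ℕ → ℤ) t (c : ℕ → ℤ) n → conv (λ i → a i + t * b i) c n ≡ conv a c n + t * conv b c n
conv-linearˡ a b t c n = begin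
  conv (λ i → a i + t * b i) c n
    ≡⟨ conv≡∑ (λ i → a i + t * b i) c n ⟩
  ∑[ i < suc n ] ((a (toℕ i) + t * b (toℕ i)) * c (n ∸ toℕ i))
    ≡⟨ sum-cong-≗ {suc n} (λ i → distrib (a (toℕ i)) (b (toℕ i)) t (c (n ∸ toℕ i))) ⟩
  ∑[ i < suc n ] (ac i + t * bc i)
    ≡⟨ ∑-distrib-+ ac (λ i → t * bc i) ⟩
  ∑[ i < suc n ] ac i + ∑[ i < suc n ] (t * bc i)
    ≡⟨ cong₂ _+_ (conv≡∑ a c n) (*-distribˡ-sum t bc) ⟨
  conv a c n + t * ∑[ i < suc n ] bc i
    ≡⟨ cong (λ s → conv a c n + t * s) (conv≡∑ b c n) ⟨
  conv a c n + t * conv b c n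
    ∎
  where
  ac bc : Fin (suc n) → ℤ
  ac i = a (toℕ i) * c (n ∸ toℕ i)
  bc i = b (toℕ i) * c (n ∸ toℕ i)
  distrib : ∀ x y t z → (x + t * y) * z ≡ x * z + t * (y * z)
  distrib = solve-∀

conv-constantˡ : ∀ (a b : ℕ → ℤ) → (∀ i → a (suc i) ≡ + 0) → ∀ n → conv a b n ≡ a 0 * b n
conv-constantˡ a b a≡0 n = begin
  conv a b n                   ≡⟨ conv≡∑ a b n ⟩
  a 0 * b n + ∑[ i < n ] ab i  ≡⟨ cong (_+_ (a 0 * b n)) (∑-≡0 ab λ i → zero-summand (toℕ i)) ⟩
  a 0 * b n + + 0              ≡⟨ ℤP.+-identityʳ _ ⟩
  a 0 * b n                    ∎
  where
  ab : Fin n → ℤ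
  ab i = a (suc (toℕ i)) * b (n ∸ suc (toℕ i))
  zero-summand : ∀ i → a (suc i) * b (n ∸ suc i) ≡ + 0
  zero-summand i = trans (cong (_* b (n ∸ suc i)) (a≡0 i)) (ℤP.*-zeroˡ (b (n ∸ suc i)))

-- The coefficients of (1 - Q x) g(x).
Δ : ℤ → (ℕ → ℤ) → ℕ → ℤ
Δ Q g zero    = g zero
Δ Q g (suc n) = g (suc n) + - Q * g n

Δ-cong : ∀ Q {g h : ℕ → ℤ} → g ≗ h → Δ Q g ≗ Δ Q h
Δ-cong Q g≗h zero    = g≗h zero
Δ-cong Q g≗h (suc n) = cong₂ (λ x y → x + - Q * y) (g≗h (suc n)) (g≗h n)

Δ-+ : ∀ Q (g h : ℕ → ℤ) n → Δ Q (λ i → g i + h i) n ≡ Δ Q g n + Δ Q h n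
Δ-+ Q g h zero    = refl
Δ-+ Q g h (suc n) = distrib (g (suc n)) (h (suc n)) (g n) (h n) (- Q)
  where
  distrib : ∀ a b c d t → (a + b) + t * (c + d) ≡ (a + t * c) + (b + t * d)
  distrib = solve-∀

conv-oneMinusQx : ∀ Q (g : ℕ → ℤ) → conv (λ m → oneMinusQx m Q) g ≗ Δ Q g
conv-oneMinusQx Q g zero    = trans (ℤP.+-identityˡ _) (ℤP.*-identityˡ (g 0))
conv-oneMinusQx Q g (suc n) = begin
  conv (λ m → oneMinusQx m Q) g (suc n)                    ≡⟨ conv-suc (λ m → oneMinusQx m Q) g n ⟩
  + 1 * g (suc n) + conv (λ m → oneMinusQx (suc m) Q) g n  ≡⟨ cong₂ _+_ (ℤP.*-identityˡ (g (suc n)))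
                                                               (conv-constantˡ (λ m → oneMinusQx (suc m) Q) g (λ _ → refl) n) ⟩
  g (suc n) + - Q * g n                                    ∎

conv-Δˡ : ∀ Q (h g : ℕ → ℤ) → conv (Δ Q h) g ≗ Δ Q (conv h g)
conv-Δˡ Q h g zero    = refl
conv-Δˡ Q h g (suc n) = begin
  conv (Δ Q h) g (suc n)                                      ≡⟨ conv-suc (Δ Q h) g n ⟩
  h 0 * g (suc n) + conv (λ i → h (suc i) + - Q * h i) g n    ≡⟨ cong (_+_ (h 0 * g (suc n))) (conv-linearˡ (h ∘ suc) h (- Q) g n) ⟩
  h 0 * g (suc n) + (conv (h ∘ suc) g n + - Q * conv h g n)   ≡⟨ ℤP.+-assoc (h 0 * g (suc n)) _ _ ⟨
  h 0 * g (suc n) + conv (h ∘ suc) g n + - Q * conv h g n     ≡⟨ cong (_+ - Q * conv h g n) (conv-suc h g n) ⟨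
  conv h g (suc n) + - Q * conv h g n                         ∎

-- x / (1 - q x) = Σ_(s≥1) q^(s-1) x^s
geometric : ℕ → ℕ → ℤ
geometric q zero    = + 0
geometric q (suc s) = + (q ^ s)

Δ-geometric : ∀ q → Δ (+ q) (geometric q) ≗ xSer
Δ-geometric q zero          = refl
Δ-geometric q (suc zero)    = cong (_+_ (+ 1)) (ℤP.*-zeroʳ (- + q))
Δ-geometric q (suc (suc s)) = begin
  + (q ℕ.* q ^ s) + - + q * + (q ^ s)  ≡⟨ cong (_+ - + q * + (q ^ s)) (ℤP.pos-* q (q ^ s)) ⟩
  + q * + (q ^ s) + - + q * + (q ^ s)  ≡⟨ cancel (+ q) (+ (q ^ s)) ⟩
  + 0                                  ∎
  where
  cancel : ∀ x y → x * y + - x * y ≡ + 0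
  cancel = solve-∀

ext-toℕ : ∀ {d} (c : Fin (suc d) → ℤ) i → ext c (toℕ i) ≡ c i
ext-toℕ {d} c i with toℕ i ℕ.<? suc d
... | yes i<1+d = cong c (FinP.fromℕ<-toℕ i i<1+d)
... | no  i≮1+d = contradiction (FinP.toℕ<n i) i≮1+d

ext-vanishes : ∀ {d} (c : Fin (suc d) → ℤ) n → suc d ≤ n → ext c n ≡ + 0
ext-vanishes {d} c n d<n with n ℕ.<? suc d
... | yes n<1+d = contradiction d<n (ℕP.<⇒≱ n<1+d)
... | no  _     = refl

-- The paper's X = (c_d, …, c_0) read as the denominator Σ_i c_i x^i, i.e. the reciprocal x^d X(1/x).
reciprocal : ∀ {d} → (Fin (suc d) → ℤ) → ℕ → ℤ
reciprocal X = ext (X ∘ opposite)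

reciprocal-opposite : ∀ {d} (X : Fin (suc d) → ℤ) i → reciprocal X (toℕ (opposite i)) ≡ X i
reciprocal-opposite X i = trans (ext-toℕ (X ∘ opposite) (opposite i)) (cong X (FinP.opposite-involutive i))

-- Σ_(s≥1) w_s x^s; the value w 0 is ignored.
series₁ : (ℕ → ℤ) → ℕ → ℤ
series₁ w zero    = + 0
series₁ w (suc s) = w (suc s)

NSer≗series₁ : ∀ (N : ℕ → ℕ) → NSer N ≗ series₁ (λ s → + N s)
NSer≗series₁ N zero    = refl
NSer≗series₁ N (suc i) = refl

numer-vanishes : ∀ d (c w : ℕ → ℤ) n → suc d ≤ n → numer d c w n ≡ + 0
numer-vanishes d c w (suc i) (s≤s d≤i) with suc i ℕ.≤? d
... | yes i<d = contradiction d≤i (ℕP.<⇒≱ i<d)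
... | no  _   = refl

Annihilates : ∀ {d} → (Fin (suc d) → ℤ) → (ℕ → ℤ) → Set
Annihilates {d} k a = ∀ j → ∑[ i < suc d ] (k i * a (j ℕ.+ toℕ i)) ≡ + 0

isGenPoly⇒annihilates : ∀ (a : ℕ → ℤ) d (k : Fin (suc d) → ℤ) → IsGenPoly a d k → Annihilates k (λ t → a (t ℕ.+ 1))
isGenPoly⇒annihilates a d k (_ , generates) j =
  trans (sym (ΣFin≡∑ (suc d) (λ i → k i * a (j ℕ.+ toℕ i ℕ.+ 1)))) (generates j)

Annihilates-shift : ∀ {d} (k : Fin (suc d) → ℤ) (a : ℕ → ℤ) → Annihilates k a → Annihilates k (λ t → a (t ℕ.+ 1))
Annihilates-shift {d} k a annihilates j =
  trans (sum-cong-≗ {suc d} λ i → cong (λ m → k i * a m) (ℕP.+-comm (j ℕ.+ toℕ i) 1)) (annihilates (suc j))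

conv-series₁-suc : ∀ (c w : ℕ → ℤ) i → conv c (series₁ w) (suc i) ≡ Σ< (suc i) (λ k → c k * w (suc i ∸ k))
conv-series₁-suc c w i = begin
  Σ< (suc i) (λ k → c k * series₁ w (suc i ∸ k)) + c (suc i) * series₁ w (i ∸ i)
    ≡⟨ cong₂ _+_ (Σ<-cong (suc i) λ k k<1+i → cong (c k *_) (series₁-pos (ℕP.m<n⇒0<n∸m k<1+i)))
                 (trans (cong (λ m → c (suc i) * series₁ w m) (ℕP.n∸n≡0 i)) (ℤP.*-zeroʳ (c (suc i)))) ⟩
  Σ< (suc i) (λ k → c k * w (suc i ∸ k)) + + 0
    ≡⟨ ℤP.+-identityʳ _ ⟩
  Σ< (suc i) (λ k → c k * w (suc i ∸ k))
    ∎
  where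
  series₁-pos : ∀ {n} → 0 < n → series₁ w n ≡ w n
  series₁-pos {suc n} _ = refl

-- The coefficient of x^(d+j+1) in (Σ c_i x^i)(Σ w_s x^s) is, read backwards, the j-th relation of the recurrence.
reciprocal-annihilates : ∀ {d} (X : Fin (suc d) → ℤ) (w : ℕ → ℤ) → Annihilates X (λ t → w (t ℕ.+ 1)) →
                         ∀ j → Σ< (suc (d ℕ.+ j)) (λ k → reciprocal X k * w (suc (d ℕ.+ j) ∸ k)) ≡ + 0
reciprocal-annihilates {d} X w annihilates j = begin
  Σ< (suc (d ℕ.+ j)) G                          ≡⟨ Σ<-pad G high (s≤s (ℕP.m≤m+n d j)) ⟩
  Σ< (suc d) G                                  ≡⟨ Σ<≡∑ (suc d) G ⟩
  ∑[ i < suc d ] G (toℕ i)                      ≡⟨ ∑-reverse {suc d} (G ∘ toℕ) ⟩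
  ∑[ i < suc d ] G (toℕ (opposite i))           ≡⟨ sum-cong-≗ {suc d} summand ⟩
  ∑[ i < suc d ] (X i * w (j ℕ.+ toℕ i ℕ.+ 1))  ≡⟨ annihilates j ⟩
  + 0                                           ∎
  where
  G : ℕ → ℤ
  G k = reciprocal X k * w (suc (d ℕ.+ j) ∸ k)

  high : ∀ k → suc d ≤ k → G k ≡ + 0
  high k d<k = trans (cong (_* w (suc (d ℕ.+ j) ∸ k)) (ext-vanishes (X ∘ opposite) k d<k))
                     (ℤP.*-zeroˡ (w (suc (d ℕ.+ j) ∸ k)))

  index : ∀ {t} → t ≤ d → suc (d ℕ.+ j) ∸ (d ∸ t) ≡ j ℕ.+ t ℕ.+ 1
  index {t} t≤d = begin
    suc (d ℕ.+ j) ∸ (d ∸ t)              ≡⟨ cong (λ m → suc (m ℕ.+ j) ∸ (d ∸ t)) (ℕP.m∸n+n≡m t≤d) ⟨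
    suc (d ∸ t ℕ.+ t ℕ.+ j) ∸ (d ∸ t)    ≡⟨ cong (_∸ (d ∸ t)) (reassoc (d ∸ t) t j) ⟩
    d ∸ t ℕ.+ (j ℕ.+ t ℕ.+ 1) ∸ (d ∸ t)  ≡⟨ ℕP.m+n∸m≡n (d ∸ t) _ ⟩
    j ℕ.+ t ℕ.+ 1                        ∎
    where
    reassoc : ∀ e t j → suc (e ℕ.+ t ℕ.+ j) ≡ e ℕ.+ (j ℕ.+ t ℕ.+ 1)
    reassoc = ℕ-Solver.solve-∀

  summand : ∀ (i : Fin (suc d)) → G (toℕ (opposite i)) ≡ X i * w (j ℕ.+ toℕ i ℕ.+ 1)
  summand i = cong₂ _*_ (reciprocal-opposite X i)
    (cong w (trans (cong (suc (d ℕ.+ j) ∸_) (FinP.opposite-prop i)) (index (ℕ.s≤s⁻¹ (FinP.toℕ<n i)))))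

conv-reciprocal-series₁ : ∀ {d} (X : Fin (suc d) → ℤ) (w : ℕ → ℤ) → Annihilates X (λ t → w (t ℕ.+ 1)) →
                          conv (reciprocal X) (series₁ w) ≗ numer d (reciprocal X) w
conv-reciprocal-series₁ X w annihilates zero = trans (ℤP.+-identityˡ _) (ℤP.*-zeroʳ (reciprocal X 0))
conv-reciprocal-series₁ {d} X w annihilates (suc i) with suc i ℕ.≤? d
... | yes _   = conv-series₁-suc (reciprocal X) w i
... | no  i≮d = begin
  conv (reciprocal X) (series₁ w) (suc i)  ≡⟨ conv-series₁-suc (reciprocal X) w i ⟩
  coefficient i                            ≡⟨ cong coefficient (ℕP.m+[n∸m]≡n (ℕ.s≤s⁻¹ (ℕP.≰⇒> i≮d))) ⟨
  coefficient (d ℕ.+ (i ∸ d))              ≡⟨ reciprocal-annihilates X w annihilates (i ∸ d) ⟩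
  + 0                                      ∎
  where
  coefficient : ℕ → ℤ
  coefficient m = Σ< (suc m) (λ k → reciprocal X k * w (suc m ∸ k))

NSer-rational : ∀ {d} (N : ℕ → ℕ) (X : Fin (suc d) → ℤ) → (∃[ j ] X j ≢ + 0) → Annihilates X (λ s → + N s) →
                ∃[ P ] ∃[ Q ] (IsPoly P × IsPoly Q × (∃[ i ] Q i ≢ + 0) × (∀ n → conv Q (NSer N) n ≡ P n))
NSer-rational {d} N X (j , Xj≢0) annihilates =
  numer d (reciprocal X) w , reciprocal X ,
  (suc d , numer-vanishes d (reciprocal X) w) ,
  (suc d , ext-vanishes (X ∘ opposite)) ,
  (toℕ (opposite j) , λ Qj≡0 → Xj≢0 (trans (sym (reciprocal-opposite X j)) Qj≡0)) ,
  λ n → trans (conv-congʳ (reciprocal X) (NSer N) (series₁ w) (NSer≗series₁ N) n)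
              (conv-reciprocal-series₁ X w (Annihilates-shift X w annihilates) n)
  where
  w : ℕ → ℤ
  w s = + N s

-- C Σ N_s x^s = C Σ u_s x^s + C x / (1 - q x), where C Σ u_s x^s is the numerator.
NSer-formula : ∀ q (N : ℕ → ℕ) (u : ℕ → ℤ) → (∀ s → u (suc s) ≡ + N (suc s) - + (q ^ s)) →
                 ∀ {d} (X : Fin (suc d) → ℤ) → Annihilates X (λ t → u (t ℕ.+ 1)) → ∀ n →
                 conv (conv (λ m → oneMinusQx m (+ q)) (reciprocal X)) (NSer N) n
                   ≡ conv xSer (reciprocal X) n + conv (λ m → oneMinusQx m (+ q)) (numer d (reciprocal X) u) n
NSer-formula q N u u≡N-q^ {d} X annihilates n = begin
  conv (conv O C) (NSer N) n              ≡⟨ conv-congˡ (conv O C) (Δ Q C) (NSer N) (conv-oneMinusQx Q C) n ⟩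
  conv (Δ Q C) (NSer N) n                 ≡⟨ conv-Δˡ Q C (NSer N) n ⟩
  Δ Q (conv C (NSer N)) n                 ≡⟨ Δ-cong Q split n ⟩
  Δ Q (λ m → conv C U m + conv C G m) n   ≡⟨ Δ-+ Q (conv C U) (conv C G) n ⟩
  Δ Q (conv C U) n + Δ Q (conv C G) n     ≡⟨ cong₂ _+_ numerator-part geometric-part ⟩
  conv O (numer d C u) n + conv xSer C n  ≡⟨ ℤP.+-comm (conv O (numer d C u) n) (conv xSer C n) ⟩
  conv xSer C n + conv O (numer d C u) n  ∎
  where
  Q = + q
  O = λ m → oneMinusQx m Q
  C = reciprocal X
  U = series₁ u
  G = geometric q

  N≗u+geometric : ∀ i → NSer N i ≡ U i + G i
  N≗u+geometric zero    = refl
  N≗u+geometric (suc s) = trans (sym (sub-add (+ N (suc s)) (+ (q ^ s)))) (cong (_+ G (suc s)) (sym (u≡N-q^ s)))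
    where
    sub-add : ∀ x y → x - y + y ≡ x
    sub-add = solve-∀

  split : ∀ m → conv C (NSer N) m ≡ conv C U m + conv C G m
  split m = trans (conv-congʳ C (NSer N) (λ i → U i + G i) N≗u+geometric m) (conv-+ʳ C U G m)

  numerator-part : Δ Q (conv C U) n ≡ conv O (numer d C u) n
  numerator-part = trans (Δ-cong Q (conv-reciprocal-series₁ X u annihilates) n) (sym (conv-oneMinusQx Q (numer d C u) n))

  geometric-part : Δ Q (conv C G) n ≡ conv xSer C n
  geometric-part = begin
    Δ Q (conv C G) n  ≡⟨ Δ-cong Q (conv-comm C G) n ⟩
    Δ Q (conv G C) n  ≡⟨ conv-Δˡ Q G C n ⟨
    conv (Δ Q G) C n  ≡⟨ conv-congˡ (Δ Q G) xSer C (Δ-geometric q) n ⟩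
    conv xSer C n     ∎

annihilates-combination : ∀ {d e} (k : Fin (suc d) → ℤ) (u : ℕ → ℤ) (X : Fin (suc e) → ℤ) → Annihilates k u →
                          Annihilates k (λ t → ∑[ l < suc e ] (X l * u (t ℕ.+ toℕ l)))
annihilates-combination {d} {e} k u X annihilates j = begin
  ∑[ i < suc d ] (k i * ∑[ l < suc e ] (X l * u (j ℕ.+ toℕ i ℕ.+ toℕ l)))
    ≡⟨ sum-cong-≗ {suc d} (λ i → *-distribˡ-sum (k i) (λ l → X l * u (j ℕ.+ toℕ i ℕ.+ toℕ l))) ⟩
  ∑[ i < suc d ] ∑[ l < suc e ] (k i * (X l * u (j ℕ.+ toℕ i ℕ.+ toℕ l)))
    ≡⟨ ∑-comm (λ i l → k i * (X l * u (j ℕ.+ toℕ i ℕ.+ toℕ l))) ⟩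
  ∑[ l < suc e ] ∑[ i < suc d ] (k i * (X l * u (j ℕ.+ toℕ i ℕ.+ toℕ l)))
    ≡⟨ sum-cong-≗ {suc e} (λ l → trans (sum-cong-≗ {suc d} (summand l)) (sym (*-distribˡ-sum (X l) (relation l)))) ⟩
  ∑[ l < suc e ] (X l * ∑[ i < suc d ] relation l i)
    ≡⟨ ∑-≡0 (λ l → X l * ∑[ i < suc d ] relation l i)
            (λ l → trans (cong (X l *_) (annihilates (j ℕ.+ toℕ l))) (ℤP.*-zeroʳ (X l))) ⟩
  + 0
    ∎
  where
  relation : Fin (suc e) → Fin (suc d) → ℤ
  relation l i = k i * u (j ℕ.+ toℕ l ℕ.+ toℕ i)

  summand : ∀ l i → k i * (X l * u (j ℕ.+ toℕ i ℕ.+ toℕ l)) ≡ X l * relation l i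
  summand l i = trans (cong (λ m → k i * (X l * u m)) (right-comm j (toℕ i) (toℕ l))) (swap (k i) (X l) _)
    where
    right-comm : ∀ j i l → j ℕ.+ i ℕ.+ l ≡ j ℕ.+ l ℕ.+ i
    right-comm = ℕ-Solver.solve-∀
    swap : ∀ x y z → x * (y * z) ≡ y * (x * z)
    swap = solve-∀

annihilated-vanishing : ∀ {d} (k : Fin (suc d) → ℤ) (b : ℕ → ℤ) → k (fromℕ d) ≢ + 0 → Annihilates k b →
                        (∀ t → t < d → b t ≡ + 0) → ∀ t → b t ≡ + 0
annihilated-vanishing {d} k b kd≢0 annihilates initial t = vanishes-below (suc t) t (ℕP.m≤m+n (suc t) d)
  where
  vanishes-below : ∀ n t → t < n ℕ.+ d → b t ≡ + 0
  vanishes-below zero    t t<d       = initial t t<d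
  vanishes-below (suc n) t t<1+n+d with ℕP.m≤n⇒m<n∨m≡n (ℕ.s≤s⁻¹ t<1+n+d)
  ... | inj₁ t<n+d = vanishes-below n t t<n+d
  ... | inj₂ refl  with ℤP.i*j≡0⇒i≡0∨j≡0 (k (fromℕ d)) leading
    where
    lower : ∀ (i : Fin d) → k (inject₁ i) * b (n ℕ.+ toℕ (inject₁ i)) ≡ + 0
    lower i = trans (cong (k (inject₁ i) *_) (vanishes-below n _ (ℕP.+-monoʳ-< n i<d))) (ℤP.*-zeroʳ (k (inject₁ i)))
      where
      i<d : toℕ (inject₁ i) < d
      i<d = subst (_< d) (sym (FinP.toℕ-inject₁ i)) (FinP.toℕ<n i)

    leading : k (fromℕ d) * b (n ℕ.+ d) ≡ + 0
    leading = begin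
      k (fromℕ d) * b (n ℕ.+ d)
        ≡⟨ ℤP.+-identityˡ _ ⟨
      + 0 + k (fromℕ d) * b (n ℕ.+ d)
        ≡⟨ cong₂ _+_ (∑-≡0 _ lower) (cong (λ m → k (fromℕ d) * b (n ℕ.+ m)) (FinP.toℕ-fromℕ d)) ⟨
      ∑[ i < d ] (k (inject₁ i) * b (n ℕ.+ toℕ (inject₁ i))) + k (fromℕ d) * b (n ℕ.+ toℕ (fromℕ d))
        ≡⟨ sum-init-last {d} (λ i → k i * b (n ℕ.+ toℕ i)) ⟨
      ∑[ i < suc d ] (k i * b (n ℕ.+ toℕ i))
        ≡⟨ annihilates n ⟩
      + 0
        ∎
  ... | inj₁ kd≡0 = contradiction kd≡0 kd≢0
  ... | inj₂ b≡0  = b≡0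

hankel-kernel-annihilates : ∀ (u : ℕ → ℤ) d (k : Fin (suc d) → ℤ) → IsGenPoly u d k → (X : Fin (suc d) → ℤ) →
                            (∀ i → (Hankel u d · X) i ≡ + 0) → Annihilates X (λ t → u (t ℕ.+ 1))
hankel-kernel-annihilates u d k genPoly@(kd≢0 , _) X kernel =
  annihilated-vanishing k b kd≢0
    (annihilates-combination k (λ t → u (t ℕ.+ 1)) X (isGenPoly⇒annihilates u d k genPoly)) row
  where
  b : ℕ → ℤ
  b t = ∑[ l < suc d ] (X l * u (t ℕ.+ toℕ l ℕ.+ 1))

  row : ∀ t → t < d → b t ≡ + 0
  row t t<d = begin
    b t                                        ≡⟨ sum-cong-≗ {suc d} entry ⟩
    ∑[ l < suc d ] (Hankel u d row-t l * X l)  ≡⟨ ΣFin≡∑ (suc d) (λ l → Hankel u d row-t l * X l) ⟨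
    (Hankel u d · X) row-t                     ≡⟨ kernel row-t ⟩
    + 0                                        ∎
    where
    row-t : Fin (suc d)
    row-t = fromℕ< (ℕP.m<n⇒m<1+n t<d)
    entry : ∀ l → X l * u (t ℕ.+ toℕ l ℕ.+ 1) ≡ Hankel u d row-t l * X l
    entry l rewrite FinP.toℕ-fromℕ< (ℕP.m<n⇒m<1+n t<d) = ℤP.*-comm (X l) (u (t ℕ.+ toℕ l ℕ.+ 1))

NontrivialRelation : ∀ {m n} → (Fin m → Fin n → ℤ) → Set
NontrivialRelation {m} v = Σ[ l ∈ (Fin m → ℤ) ] ((∃[ i ] l i ≢ + 0) × (∀ c → ∑[ i < m ] (l i * v i c) ≡ + 0))

relation-zeroColumn : ∀ {m n} (v : Fin m → Fin (suc n) → ℤ) → (∀ i → v i zero ≡ + 0) →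
                      NontrivialRelation (λ i c → v i (suc c)) → NontrivialRelation v
relation-zeroColumn {m} v column≡0 (l , nontrivial , relation) = l , nontrivial , λ where
  zero    → ∑-≡0 {m} (λ i → l i * v i zero) (λ i → trans (cong (l i *_) (column≡0 i)) (ℤP.*-zeroʳ (l i)))
  (suc c) → relation c

eliminate : ∀ {m n} → (Fin (suc m) → Fin (suc n) → ℤ) → Fin (suc m) → Fin m → Fin n → ℤ
eliminate v p j c = v p zero * v (punchIn p j) (suc c) - v (punchIn p j) zero * v p (suc c)

-- A relation μ among the eliminated rows lifts to a·μ_j on the rows j ≠ p and -Σ_j μ_j v_j0 on the pivot row.
relation-pivot : ∀ {m n} (v : Fin (suc m) → Fin (suc n) → ℤ) p → v p zero ≢ + 0 →
                 NontrivialRelation (eliminate v p) → NontrivialRelation v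
relation-pivot {m} v p a≢0 (μ , (j₀ , μj₀≢0) , μ-relation) = l , (punchIn p j₀ , l≢0) , relation
  where
  a = v p zero
  z : Fin m → ℤ
  z j = μ j * v (punchIn p j) zero
  S = ∑[ j < m ] z j
  l = insertAt (λ j → a * μ j) p (- S)

  l≢0 : l (punchIn p j₀) ≢ + 0
  l≢0 l≡0 = [ a≢0 , μj₀≢0 ]′ (ℤP.i*j≡0⇒i≡0∨j≡0 a (trans (sym (insertAt-punchIn (λ j → a * μ j) p (- S) j₀)) l≡0))

  split : ∀ c → ∑[ i < suc m ] (l i * v i c) ≡ - S * v p c + ∑[ j < m ] (a * μ j * v (punchIn p j) c)
  split c = trans (sum-remove {i = p} (λ i → l i * v i c))
                  (cong₂ _+_ (cong (_* v p c) (insertAt-lookup (λ j → a * μ j) p (- S)))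
                             (sum-cong-≗ {m} λ j → cong (_* v (punchIn p j) c) (insertAt-punchIn (λ j → a * μ j) p (- S) j)))

  relation : ∀ c → ∑[ i < suc m ] (l i * v i c) ≡ + 0
  relation zero = begin
    ∑[ i < suc m ] (l i * v i zero)                        ≡⟨ split zero ⟩
    - S * a + ∑[ j < m ] (a * μ j * v (punchIn p j) zero)  ≡⟨ cong (_+_ (- S * a)) (sum-cong-≗ {m} λ j → ℤP.*-assoc a (μ j) _) ⟩
    - S * a + ∑[ j < m ] (a * z j)                         ≡⟨ cong (_+_ (- S * a)) (*-distribˡ-sum a z) ⟨
    - S * a + a * S                                        ≡⟨ cancel S a ⟩
    + 0                                                    ∎
    where
    cancel : ∀ S a → - S * a + a * S ≡ + 0
    cancel = solve-∀
  relation (suc c) = begin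
    ∑[ i < suc m ] (l i * v i (suc c))            ≡⟨ split (suc c) ⟩
    - S * t + ∑[ j < m ] y j                      ≡⟨ reorder S t (∑[ j < m ] y j) ⟩
    ∑[ j < m ] y j + - t * S                      ≡⟨ cong (_+_ (∑[ j < m ] y j)) (*-distribˡ-sum (- t) z) ⟩
    ∑[ j < m ] y j + ∑[ j < m ] (- t * z j)       ≡⟨ ∑-distrib-+ y (λ j → - t * z j) ⟨
    ∑[ j < m ] (y j + - t * z j)                  ≡⟨ sum-cong-≗ {m} (λ j → expand (μ j) a (v (punchIn p j) (suc c)) (v (punchIn p j) zero) t) ⟩
    ∑[ j < m ] (μ j * eliminate v p j c)          ≡⟨ μ-relation c ⟩
    + 0                                           ∎
    where
    t = v p (suc c)
    y : Fin m → ℤ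
    y j = a * μ j * v (punchIn p j) (suc c)
    reorder : ∀ S t Y → - S * t + Y ≡ Y + - t * S
    reorder = solve-∀
    expand : ∀ μ a y z t → a * μ * y + - t * (μ * z) ≡ μ * (a * y - z * t)
    expand = solve-∀

-- Fraction-free Gaussian elimination on the first column.
nontrivialRelation : ∀ {m n} → n < m → (v : Fin m → Fin n → ℤ) → NontrivialRelation v
nontrivialRelation {suc m} {zero}  _         v = (λ _ → + 1) , (zero , λ ()) , λ ()
nontrivialRelation {suc m} {suc n} (s≤s n<m) v with FinP.any? (λ i → ¬? (v i zero ℤ.≟ + 0))
... | yes (p , pivot≢0) = relation-pivot v p pivot≢0 (nontrivialRelation n<m (eliminate v p))
... | no  noPivot       = relation-zeroColumn v (λ i → decidable-stable (v i zero ℤ.≟ + 0) (λ v≢0 → noPivot (i , v≢0)))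
                                              (nontrivialRelation (ℕP.m<n⇒m<1+n n<m) (λ i c → v i (suc c)))

length-filter-concatMap : ∀ {A B : Set} {P : Pred B 0ℓ} (P? : Decidable P) (g : A → List B) xs →
  length (filter P? (concatMap g xs)) ≡ ℕ-List.sum (map (λ x → length (filter P? (g x))) xs)
length-filter-concatMap P? g []       = refl
length-filter-concatMap P? g (x ∷ xs) = begin
  length (filter P? (g x List.++ concatMap g xs))
    ≡⟨ cong length (ListP.filter-++ P? (g x) (concatMap g xs)) ⟩
  length (filter P? (g x) List.++ filter P? (concatMap g xs))
    ≡⟨ ListP.length-++ (filter P? (g x)) ⟩
  length (filter P? (g x)) ℕ.+ length (filter P? (concatMap g xs))
    ≡⟨ cong (length (filter P? (g x)) ℕ.+_) (length-filter-concatMap P? g xs) ⟩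
  ℕ-List.sum (map (λ x → length (filter P? (g x))) (x ∷ xs))
    ∎

length-filter-map : ∀ {A B : Set} {P : Pred B 0ℓ} {Q : Pred A 0ℓ} (P? : Decidable P) (Q? : Decidable Q) (h : A → B) →
  (P ∘ h) ≐ Q → ∀ xs → length (filter P? (map h xs)) ≡ length (filter Q? xs)
length-filter-map P? Q? h P∘h≐Q []       = refl
length-filter-map P? Q? h P∘h≐Q (x ∷ xs) with P? (h x) | Q? x
... | yes _   | yes _   = cong suc (length-filter-map P? Q? h P∘h≐Q xs)
... | no  _   | no  _   = length-filter-map P? Q? h P∘h≐Q xs
... | yes Phx | no  ¬Qx = contradiction (proj₁ P∘h≐Q Phx) ¬Qx
... | no  ¬Phx | yes Qx = contradiction (proj₂ P∘h≐Q Qx) ¬Phx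

pos-sum-tabulate : ∀ {n} (h : Fin n → ℕ) → + ℕ-List.sum (tabulate h) ≡ ∑[ i < n ] (+ h i)
pos-sum-tabulate {zero}  h = refl
pos-sum-tabulate {suc n} h = trans (ℤP.pos-+ (h zero) _) (cong (_+_ (+ h zero)) (pos-sum-tabulate (h ∘ suc)))

module Counting {q : ℕ} (F : FiniteField q) (f : List (FiniteField.Carrier F)) where
  open FiniteField F
  private
    ring : CommutativeRing _ _
    ring = record { isCommutativeRing = isCommutativeRing }
    open GroupProperties (CommutativeRing.+-group ring) using (quasigroup; \\-leftDividesˡ)
    open QuasigroupProperties quasigroup using (y≈x\\z)

    residual : Carrier → Fin q → Carrier
    residual b c = -F eval f (Inverse.to enum c) +F b

  N-suc : ∀ b s → + N f b (suc s) ≡ ∑[ c < q ] (+ N f (residual b c) s)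
  N-suc b s = begin
    + length (filter (has-sum b) (concatMap prepend elements))
      ≡⟨ cong +_ (length-filter-concatMap (has-sum b) prepend elements) ⟩
    + ℕ-List.sum (map (λ x → length (filter (has-sum b) (prepend x))) elements)
      ≡⟨ cong (+_ ∘ ℕ-List.sum) (ListP.map-cong first-entry elements) ⟩
    + ℕ-List.sum (map (λ x → N f (-F eval f x +F b) s) elements)
      ≡⟨ cong (+_ ∘ ℕ-List.sum) enumerate ⟩
    + ℕ-List.sum (tabulate (λ c → N f (residual b c) s))
      ≡⟨ pos-sum-tabulate (λ c → N f (residual b c) s) ⟩
    ∑[ c < q ] (+ N f (residual b c) s)
      ∎
    where
    has-sum : ∀ b {s} → Decidable (λ (v : Vec Carrier s) → sumF (Vec.map (eval f) v) ≡ b)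
    has-sum b v = sumF (Vec.map (eval f) v) ≟F b

    prepend : Carrier → List (Vec Carrier (suc s))
    prepend x = map (x Vec.∷_) (tuples s)

    first-entry : ∀ x → length (filter (has-sum b) (prepend x)) ≡ N f (-F eval f x +F b) s
    first-entry x = length-filter-map (has-sum b) (has-sum (-F eval f x +F b)) (x Vec.∷_)
      (y≈x\\z _ _ b , λ S≡ → trans (cong (eval f x +F_) S≡) (\\-leftDividesˡ (eval f x) b)) (tuples s)

    enumerate : map (λ x → N f (-F eval f x +F b) s) elements ≡ tabulate (λ c → N f (residual b c) s)
    enumerate = trans (sym (ListP.map-∘ (List.allFin q))) (ListP.map-tabulate (λ c → c) _)

  relation-propagates : ∀ {e} (l : Fin (suc e) → ℤ) → (∀ b → ∑[ i < suc e ] (l i * + N f b (toℕ i)) ≡ + 0) →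
                        ∀ b → Annihilates l (λ s → + N f b s)
  relation-propagates {e} l initial b zero    = initial b
  relation-propagates {e} l initial b (suc j) = begin
    ∑[ i < suc e ] (l i * + N f b (suc (j ℕ.+ toℕ i)))
      ≡⟨ sum-cong-≗ {suc e} (λ i → trans (cong (l i *_) (N-suc b (j ℕ.+ toℕ i))) (*-distribˡ-sum (l i) (term i))) ⟩
    ∑[ i < suc e ] ∑[ c < q ] (l i * term i c)
      ≡⟨ ∑-comm (λ i c → l i * term i c) ⟩
    ∑[ c < q ] ∑[ i < suc e ] (l i * term i c)
      ≡⟨ ∑-≡0 (λ c → ∑[ i < suc e ] (l i * term i c)) (λ c → relation-propagates l initial (residual b c) j) ⟩
    + 0
      ∎
    where
    term : Fin (suc e) → Fin q → ℤ
    term i c = + N f (residual b c) (j ℕ.+ toℕ i)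

  -- Since F has q elements, the q + 1 functions b ↦ N_i(f, b), i ≤ q, are linearly dependent.
  N-annihilator : Σ[ l ∈ (Fin (suc q) → ℤ) ] ((∃[ i ] l i ≢ + 0) × (∀ b → Annihilates l (λ s → + N f b s)))
  N-annihilator with nontrivialRelation (ℕP.n<1+n q) (λ i c → + N f (Inverse.to enum c) (toℕ i))
  ... | l , nontrivial , relation = l , nontrivial , relation-propagates l initial
    where
    initial : ∀ b → ∑[ i < suc q ] (l i * + N f b (toℕ i)) ≡ + 0
    initial b = subst (λ b → ∑[ i < suc q ] (l i * + N f b (toℕ i)) ≡ + 0)
                      (Inverse.strictlyInverseˡ enum b) (relation (Inverse.from enum b))

theorem1p2 : (p k : ℕ) → Prime p → 1 ≤ k → (F : FiniteField (p ^ k)) →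
    (f : List (FiniteField.Carrier F)) → (a : FiniteField.Carrier F) →
    -- the generating series Σ N_s x^s is rational: Q · S = P
    (∃[ P ] ∃[ Q ] (IsPoly P × IsPoly Q × (∃[ i ] Q i ≢ + 0) ×
      (∀ n → conv Q (NSer (FiniteField.N F f a)) n ≡ P n)))
    ×
    -- explicit formula
    ((d : ℕ) → SeqDeg (FiniteField.u F f a) d →
     (X : Fin (suc d) → ℤ) → (∃[ j ] X j ≢ + 0) →
     (∀ i → (Hankel (FiniteField.u F f a) d · X) i ≡ + 0) →
     ∀ n → conv (conv (λ m → oneMinusQx m (+ (p ^ k))) (ext (λ i → X (opposite i))))
                (NSer (FiniteField.N F f a)) n
           ≡ conv xSer (ext (λ i → X (opposite i))) n
             + conv (λ m → oneMinusQx m (+ (p ^ k)))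
                    (numer d (ext (λ i → X (opposite i))) (FiniteField.u F f a)) n)
theorem1p2 p k _ _ F f a = rationality , formula
  where
  open FiniteField F using (N; u)
  open Counting F f using (N-annihilator)

  rationality : ∃[ P ] ∃[ Q ] (IsPoly P × IsPoly Q × (∃[ i ] Q i ≢ + 0) × (∀ n → conv Q (NSer (N f a)) n ≡ P n))
  rationality = let l , nontrivial , annihilates = N-annihilator in NSer-rational (N f a) l nontrivial (annihilates a)

  formula : (d : ℕ) → SeqDeg (u f a) d → (X : Fin (suc d) → ℤ) → (∃[ j ] X j ≢ + 0) →
            (∀ i → (Hankel (u f a) d · X) i ≡ + 0) → ∀ n →
            conv (conv (λ m → oneMinusQx m (+ (p ^ k))) (reciprocal X)) (NSer (N f a)) n
              ≡ conv xSer (reciprocal X) n + conv (λ m → oneMinusQx m (+ (p ^ k))) (numer d (reciprocal X) (u f a)) n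
  formula d ((g , genPoly) , _) X _ kernel =
    NSer-formula (p ^ k) (N f a) (u f a) (λ _ → refl) X (hankel-kernel-annihilates (u f a) d g genPoly X kernel)
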